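{- Let $n\in\mathbb{N}^*$, let $\mathcal{A}_1,\ldots,\mathcal{A}_n$ be non-empty algebras in $\mathcal{C}$, and let $\mathcal{A}=\prod_{i=1}^n\mathcal{A}_i$. Then $\mathcal{A}$ has CBLP iff $\mathcal{A}_i$ has CBLP for every $i\in\{1,\ldots,n\}$.
   Context: $\mathcal{C}$ is an equational class of congruence-distributive algebras of some signature, such that every non-empty algebra $\mathcal{A}$ in $\mathcal{C}$ satisfies (H): $\nabla_{\mathcal{A}}=A^2$ is compact in the congruence lattice ${\rm Con}(\mathcal{A})$. Direct products carry componentwise operations. $\mathcal{B}(L)$ denotes the Boolean center of a bounded distributive lattice $L$. For $\theta\in{\rm Con}(\mathcal{A})$, $u_\theta:{\rm Con}(\mathcal{A})\to{\rm Con}(\mathcal{A}/\theta)$, $u_\theta(\alpha)=(\alpha\vee\theta)/\theta$ (with $\phi/\theta=\{(a/\theta,b/\theta)\mid(a,b)\in\phi\}$); $\theta$ has CBLP iff the restriction of $u_\theta$ from $\mathcal{B}({\rm Con}(\mathcal{A}))$ to $\mathcal{B}({\rm Con}(\mathcal{A}/\theta))$ is surjective; an algebra has CBLP iff all its congruences have CBLP. -}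

module Defs where

open import Level using (Level; _⊔_; 0ℓ) renaming (suc to lsuc)
open import Data.Nat using (ℕ)
open import Data.Fin using (Fin)
open import Data.Product using (Σ; _×_; _,_; proj₁; proj₂)
open import Data.Sum using (_⊎_; inj₁; inj₂)
open import Data.Unit using (⊤; tt)
open import Relation.Binary.Structures using (IsEquivalence)

record Signature : Set₁ where
  field
    Op    : Set
    arity : Op → ℕ
open Signature public

data Term (S : Signature) : Set where
  var : ℕ → Term S
  app : (f : Op S) → (Fin (arity S f) → Term S) → Term S

-- An algebra is given on a setoid (so that quotient algebras A/θ are
-- available without quotient types): the algebra is Carrier/≈.
record Algebra (S : Signature) : Set₁ where
  field
    Carrier : Set
    _≈_     : Carrier → Carrier → Set
    isEquiv : IsEquivalence _≈_
    op      : (f : Op S) → (Fin (arity S f) → Carrier) → Carrier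
    op-cong : ∀ f {xs ys} → (∀ i → xs i ≈ ys i) → op f xs ≈ op f ys
open Algebra public

module _ {S : Signature} where

  ⟦_⟧ : Term S → (A : Algebra S) → (ℕ → Carrier A) → Carrier A
  ⟦ var x ⟧ A ρ = ρ x
  ⟦ app f ts ⟧ A ρ = op A f (λ i → ⟦ ts i ⟧ A ρ)

  -- A belongs to the equational class defined by the identities E
  Models : (Term S → Term S → Set) → Algebra S → Set
  Models E A = ∀ s t → E s t → ∀ (ρ : ℕ → Carrier A) → _≈_ A (⟦ s ⟧ A ρ) (⟦ t ⟧ A ρ)

  NonEmpty : Algebra S → Set
  NonEmpty A = Carrier A

  record Con (A : Algebra S) : Set₁ where
    field
      rel     : Carrier A → Carrier A → Set
      isEquiv : IsEquivalence rel
      ≈⇒rel   : ∀ {x y} → _≈_ A x y → rel x y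
      compat  : ∀ f {xs ys} → (∀ i → rel (xs i) (ys i)) → rel (op A f xs) (op A f ys)
  open Con public

  data Gen {ℓ : Level} (A : Algebra S) (R : Carrier A → Carrier A → Set ℓ)
         : Carrier A → Carrier A → Set ℓ where
    g-base   : ∀ {x y} → R x y → Gen A R x y
    g-eq     : ∀ {x y} → _≈_ A x y → Gen A R x y
    g-sym    : ∀ {x y} → Gen A R x y → Gen A R y x
    g-trans  : ∀ {x y z} → Gen A R x y → Gen A R y z → Gen A R x z
    g-compat : ∀ f {xs ys} → (∀ i → Gen A R (xs i) (ys i)) → Gen A R (op A f xs) (op A f ys)

  module _ {A : Algebra S} where

    _≤C_ : Con A → Con A → Set
    α ≤C β = ∀ {x y} → rel α x y → rel β x y

    _≅C_ : Con A → Con A → Set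
    α ≅C β = (α ≤C β) × (β ≤C α)

    Δ : Con A
    Δ = record { rel = _≈_ A ; isEquiv = isEquiv A ; ≈⇒rel = λ p → p
               ; compat = op-cong A }

    ∇ : Con A
    ∇ = record { rel = λ _ _ → ⊤
               ; isEquiv = record { refl = tt ; sym = λ _ → tt ; trans = λ _ _ → tt }
               ; ≈⇒rel = λ _ → tt ; compat = λ _ _ → tt }

    _∧_ : Con A → Con A → Con A
    α ∧ β = record
      { rel = λ x y → rel α x y × rel β x y
      ; isEquiv = record
          { refl = IsEquivalence.refl (isEquiv α) , IsEquivalence.refl (isEquiv β)
          ; sym = λ p → IsEquivalence.sym (isEquiv α) (proj₁ p) , IsEquivalence.sym (isEquiv β) (proj₂ p)
          ; trans = λ p q → IsEquivalence.trans (isEquiv α) (proj₁ p) (proj₁ q)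
                          , IsEquivalence.trans (isEquiv β) (proj₂ p) (proj₂ q) }
      ; ≈⇒rel = λ p → ≈⇒rel α p , ≈⇒rel β p
      ; compat = λ f ps → compat α f (λ i → proj₁ (ps i)) , compat β f (λ i → proj₂ (ps i)) }

    _∨_ : Con A → Con A → Con A
    α ∨ β = record
      { rel = Gen A (λ x y → rel α x y ⊎ rel β x y)
      ; isEquiv = record { refl = g-eq (IsEquivalence.refl (isEquiv A)) ; sym = g-sym ; trans = g-trans }
      ; ≈⇒rel = g-eq
      ; compat = g-compat }

    ⋁ : (Con A → Set) → Carrier A → Carrier A → Set₁
    ⋁ P = Gen A (λ x y → Σ (Con A) λ γ → P γ × rel γ x y)

    ⋁fin : {k : ℕ} → (Fin k → Con A) → Carrier A → Carrier A → Set
    ⋁fin {k} γs = Gen A (λ x y → Σ (Fin k) λ j → rel (γs j) x y)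

    IsBoolean : Con A → Set₁
    IsBoolean α = Σ (Con A) λ β → ((α ∧ β) ≅C Δ) × ((α ∨ β) ≅C ∇)

  NablaCompact : Algebra S → Set₁
  NablaCompact A = (P : Con A → Set) → (∀ x y → ⋁ P x y) →
    Σ ℕ λ k → Σ (Fin k → Con A) λ γs → (∀ j → P (γs j)) × (∀ x y → ⋁fin γs x y)

  CongDistributive : Algebra S → Set₁
  CongDistributive A = (α β γ : Con A) → (α ∧ (β ∨ γ)) ≅C ((α ∧ β) ∨ (α ∧ γ))

  _/_ : (A : Algebra S) → Con A → Algebra S
  A / θ = record { Carrier = Carrier A ; _≈_ = rel θ ; isEquiv = isEquiv θ
                 ; op = op A ; op-cong = compat θ }

  u : {A : Algebra S} (θ : Con A) → Con A → Con (A / θ)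
  u θ α = record { rel = rel (α ∨ θ) ; isEquiv = isEquiv (α ∨ θ)
                 ; ≈⇒rel = λ p → g-base (inj₂ p) ; compat = g-compat }

  CBLPcon : {A : Algebra S} → Con A → Set₁
  CBLPcon {A} θ = (β : Con (A / θ)) → IsBoolean β →
    Σ (Con A) λ α → IsBoolean α × (u θ α ≅C β)

  HasCBLP : Algebra S → Set₁
  HasCBLP A = (θ : Con A) → CBLPcon θ

  Π : {n : ℕ} → (Fin n → Algebra S) → Algebra S
  Π {n} A = record
    { Carrier = (i : Fin n) → Carrier (A i)
    ; _≈_ = λ x y → ∀ i → _≈_ (A i) (x i) (y i)
    ; isEquiv = record
        { refl = λ i → IsEquivalence.refl (isEquiv (A i))
        ; sym = λ p i → IsEquivalence.sym (isEquiv (A i)) (p i)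
        ; trans = λ p q i → IsEquivalence.trans (isEquiv (A i)) (p i) (q i) }
    ; op = λ f xs i → op (A i) f (λ j → xs j i)
    ; op-cong = λ f ps i → op-cong (A i) f (λ j → ps j i) }

module Submission where

-- Let P = Π Aᵢ and let ηᵢ be the kernel of the i-th projection.
-- Fix a point c of P (the factors are non-empty) and embed Aᵢ into P by
-- ιᵢ a = c[i := a]; it is a homomorphism up to ηᵢ.  The i-th component of a
-- congruence κ of P is the pull-back of κ ∨ ηᵢ along ιᵢ.  Since ⋀ᵢ ηᵢ = Δ,
-- congruence distributivity of P gives κ = Πᵢ (κ ∨ ηᵢ), so κ is the product of
-- its components (the Fraser–Horn property), and components commute with the
-- lattice operations that matter.  Hence:
--   * factors ⇒ product: the components of θ and of a Boolean β ∈ Con(P/θ) are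
--     Boolean; lift them in each factor and take the product congruence;
--   * product ⇒ factor: pull θᵢ and a Boolean βᵢ back along the i-th projection,
--     lift in P, and take the i-th component of the lift.

open import Defs
open import Data.Nat using (ℕ; _≤_; zero; suc)
open import Data.Fin using (Fin) renaming (zero to fzero; suc to fsuc)
open import Data.Product using (Σ; _×_; _,_; proj₁; proj₂)
open import Data.Sum using (_⊎_; inj₁; inj₂)
open import Data.Unit using (tt)
open import Relation.Binary.PropositionalEquality using (_≡_; refl; sym; subst₂)
open import Relation.Binary.Structures using (IsEquivalence)
open import Function.Bundles using (_⇔_; mk⇔)

module _ {S : Signature} {B : Algebra S} where

  con-refl : (κ : Con B) → ∀ {x} → rel κ x x
  con-refl κ = IsEquivalence.refl (Con.isEquiv κ)

  con-sym : (κ : Con B) → ∀ {x y} → rel κ x y → rel κ y x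
  con-sym κ = IsEquivalence.sym (Con.isEquiv κ)

  con-trans : (κ : Con B) → ∀ {x y z} → rel κ x y → rel κ y z → rel κ x z
  con-trans κ = IsEquivalence.trans (Con.isEquiv κ)

module _ {S : Signature} (B : Algebra S) where

  ≈-refl : ∀ {x} → _≈_ B x x
  ≈-refl = IsEquivalence.refl (Algebra.isEquiv B)

  ≈-sym : ∀ {x y} → _≈_ B x y → _≈_ B y x
  ≈-sym = IsEquivalence.sym (Algebra.isEquiv B)

  ≈-trans : ∀ {x y z} → _≈_ B x y → _≈_ B y z → _≈_ B x z
  ≈-trans = IsEquivalence.trans (Algebra.isEquiv B)

module Lattice {S : Signature} (B : Algebra S) where

  Gen-least : {R : Carrier B → Carrier B → Set} (γ : Con B) →
    (∀ {x y} → R x y → rel γ x y) → ∀ {x y} → Gen B R x y → rel γ x y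
  Gen-least γ h (g-base r)      = h r
  Gen-least γ h (g-eq e)        = ≈⇒rel γ e
  Gen-least γ h (g-sym p)       = con-sym γ (Gen-least γ h p)
  Gen-least γ h (g-trans p q)   = con-trans γ (Gen-least γ h p) (Gen-least γ h q)
  Gen-least γ h (g-compat f ps) = compat γ f (λ k → Gen-least γ h (ps k))

  generated : (Carrier B → Carrier B → Set) → Con B
  generated R = record
    { rel = Gen B R
    ; isEquiv = record { refl = g-eq (≈-refl B) ; sym = g-sym ; trans = g-trans }
    ; ≈⇒rel = g-eq ; compat = g-compat }

  Gen-mono : {R R' : Carrier B → Carrier B → Set} →
    (∀ {x y} → R x y → Gen B R' x y) → ∀ {x y} → Gen B R x y → Gen B R' x y
  Gen-mono {R' = R'} = Gen-least (generated R')

  ∨-comm : (α β : Con B) → (α ∨ β) ≤C (β ∨ α)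
  ∨-comm α β = Gen-mono λ { (inj₁ a) → g-base (inj₂ a) ; (inj₂ b) → g-base (inj₁ b) }

  ∨-monoˡ : (α α' β : Con B) → α ≤C α' → (α ∨ β) ≤C (α' ∨ β)
  ∨-monoˡ α α' β h =
    Gen-mono λ { (inj₁ a) → g-base (inj₁ (h a)) ; (inj₂ b) → g-base (inj₂ b) }

  ∨-monoʳ : (α β β' : Con B) → β ≤C β' → (α ∨ β) ≤C (α ∨ β')
  ∨-monoʳ α β β' h =
    Gen-mono λ { (inj₁ a) → g-base (inj₁ a) ; (inj₂ b) → g-base (inj₂ (h b)) }

  -- The dual distributive law, derived from distributivity of ∧ over ∨.
  ∨-dual-distrib : CongDistributive B → (θ α β : Con B) →
    ((θ ∨ α) ∧ (θ ∨ β)) ≤C (θ ∨ (α ∧ β))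
  ∨-dual-distrib cd θ α β (p , q) = Gen-mono outer (proj₁ (cd (θ ∨ α) θ β) (p , q))
    where
    inner : ∀ {x y} → rel (β ∧ θ) x y ⊎ rel (β ∧ α) x y →
      Gen B (λ x y → rel θ x y ⊎ rel (α ∧ β) x y) x y
    inner (inj₁ (_ , t)) = g-base (inj₁ t)
    inner (inj₂ (b , a)) = g-base (inj₂ (a , b))
    -- (θ ∨ α) ∧ β ≤ (β ∧ θ) ∨ (β ∧ α) by distributivity once more
    outer : ∀ {x y} → rel ((θ ∨ α) ∧ θ) x y ⊎ rel ((θ ∨ α) ∧ β) x y →
      Gen B (λ x y → rel θ x y ⊎ rel (α ∧ β) x y) x y
    outer (inj₁ (_ , t)) = g-base (inj₁ t)
    outer (inj₂ (s , b)) = Gen-mono inner (proj₁ (cd β θ α) (b , s))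

  ⋀ : {m : ℕ} → (Fin m → Con B) → Con B
  ⋀ γ = record
    { rel = λ x y → ∀ j → rel (γ j) x y
    ; isEquiv = record { refl = λ j → con-refl (γ j) ; sym = λ p j → con-sym (γ j) (p j)
                       ; trans = λ p q j → con-trans (γ j) (p j) (q j) }
    ; ≈⇒rel = λ e j → ≈⇒rel (γ j) e
    ; compat = λ f ps j → compat (γ j) f (λ k → ps k j) }

  ⋀-dual-distrib : CongDistributive B → (θ : Con B) {m : ℕ} (γ : Fin m → Con B) →
    ∀ {x y} → (∀ j → rel (θ ∨ γ j) x y) → rel (θ ∨ ⋀ γ) x y
  ⋀-dual-distrib cd θ {zero} γ H = g-base (inj₂ λ ())
  ⋀-dual-distrib cd θ {suc m} γ H =
    Gen-mono cons (∨-dual-distrib cd θ (γ fzero) (⋀ γ⁺)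
                    (H fzero , ⋀-dual-distrib cd θ γ⁺ (λ j → H (fsuc j))))
    where
    γ⁺ : Fin m → Con B
    γ⁺ j = γ (fsuc j)
    cons : ∀ {x y} → rel θ x y ⊎ rel (γ fzero ∧ ⋀ γ⁺) x y →
      Gen B (λ x y → rel θ x y ⊎ rel (⋀ γ) x y) x y
    cons (inj₁ t) = g-base (inj₁ t)
    cons (inj₂ (g , gs)) = g-base (inj₂ λ { fzero → g ; (fsuc j) → gs j })

  -- A congruence with a complement lies in the Boolean centre (the two
  -- remaining inclusions hold in any lattice of congruences).
  complemented : (α β : Con B) → (α ∧ β) ≤C Δ → ∇ ≤C (α ∨ β) → IsBoolean α
  complemented α β meet cover =
    β , (meet , λ e → ≈⇒rel α e , ≈⇒rel β e) , ((λ _ → tt) , cover)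

  lower : (θ : Con B) → Con (B / θ) → Con B
  lower θ β = record { rel = rel β ; isEquiv = Con.isEquiv β
                     ; ≈⇒rel = λ e → ≈⇒rel β (≈⇒rel θ e) ; compat = compat β }

  raise : (θ γ : Con B) → θ ≤C γ → Con (B / θ)
  raise θ γ θ≤γ = record { rel = rel γ ; isEquiv = Con.isEquiv γ
                         ; ≈⇒rel = θ≤γ ; compat = compat γ }

open Lattice

record HomUpTo {S : Signature} (B C : Algebra S) (γ : Con C) : Set where
  field
    map    : Carrier B → Carrier C
    resp   : ∀ {a b} → _≈_ B a b → rel γ (map a) (map b)
    op-hom : ∀ f xs → rel γ (map (op B f xs)) (op C f (λ k → map (xs k)))
open HomUpTo public

Hom : {S : Signature} → Algebra S → Algebra S → Set
Hom B C = HomUpTo B C Δ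

module _ {S : Signature} {B C : Algebra S} {γ : Con C} (h : HomUpTo B C γ) where

  preimage : (ρ : Con C) → γ ≤C ρ → Con B
  preimage ρ γ≤ρ = record
    { rel = λ a b → rel ρ (map h a) (map h b)
    ; isEquiv = record { refl = con-refl ρ ; sym = con-sym ρ ; trans = con-trans ρ }
    ; ≈⇒rel = λ e → γ≤ρ (resp h e)
    ; compat = λ f {xs} {ys} ps → con-trans ρ (γ≤ρ (op-hom h f xs))
        (con-trans ρ (compat ρ f ps) (con-sym ρ (γ≤ρ (op-hom h f ys)))) }

  quotient-hom : (κ : Con B) (θ : Con C) → γ ≤C θ →
    (∀ {a b} → rel κ a b → rel θ (map h a) (map h b)) → Hom (B / κ) (C / θ)
  quotient-hom κ θ γ≤θ hκ =
    record { map = map h ; resp = hκ ; op-hom = λ f xs → γ≤θ (op-hom h f xs) }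

module _ {S : Signature} {B C : Algebra S} (h : Hom B C) (ρ ρ' : Con B) (σ σ' : Con C)
         (hρ : ∀ {a b} → rel ρ a b → rel σ (map h a) (map h b))
         (hρ' : ∀ {a b} → rel ρ' a b → rel σ' (map h a) (map h b)) where

  join-image : ∀ {a b} → rel (ρ ∨ ρ') a b → rel (σ ∨ σ') (map h a) (map h b)
  join-image = Gen-least B (preimage h (σ ∨ σ') g-eq)
    λ { (inj₁ r) → g-base (inj₁ (hρ r)) ; (inj₂ r) → g-base (inj₂ (hρ' r)) }

  join-cover-image : (s : Carrier C → Carrier B) → (∀ c → _≈_ C (map h (s c)) c) →
    ∇ ≤C (ρ ∨ ρ') → ∇ ≤C (σ ∨ σ')
  join-cover-image s section cover {c} {d} _ =
    g-trans (g-eq (≈-sym C (section c)))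
      (g-trans (join-image {s c} {s d} (cover tt)) (g-eq (section d)))

update : ∀ {n} {X : Fin n → Set} → (∀ j → X j) → (i : Fin n) → X i → ∀ j → X j
update c fzero    a fzero    = a
update c fzero    a (fsuc j) = c (fsuc j)
update c (fsuc i) a fzero    = c fzero
update c (fsuc i) a (fsuc j) = update (λ k → c (fsuc k)) i a j

update-at : ∀ {n} {X : Fin n → Set} (c : ∀ j → X j) (i : Fin n) (a : X i) →
  update c i a i ≡ a
update-at c fzero    a = refl
update-at c (fsuc i) a = update-at (λ k → c (fsuc k)) i a

update-rel : ∀ {n} {X : Fin n → Set} (c : ∀ j → X j) (R : ∀ j → X j → X j → Set) →
  (∀ j → R j (c j) (c j)) → ∀ i {a b} → R i a b → ∀ j → R j (update c i a j) (update c i b j)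
update-rel c R rc fzero    r fzero    = r
update-rel c R rc fzero    r (fsuc j) = rc (fsuc j)
update-rel c R rc (fsuc i) r fzero    = rc fzero
update-rel c R rc (fsuc i) r (fsuc j) =
  update-rel (λ k → c (fsuc k)) (λ k → R (fsuc k)) (λ k → rc (fsuc k)) i r j

module Product {S : Signature} {n : ℕ} (A : Fin n → Algebra S) where

  P : Algebra S
  P = Π A

  proj : (i : Fin n) → Hom P (A i)
  proj i = record { map = λ x → x i ; resp = λ e → e i ; op-hom = λ f xs → ≈-refl (A i) }

  η : (i : Fin n) → Con P
  η i = preimage (proj i) Δ (λ e → e)

  Πᶜ : ((i : Fin n) → Con (A i)) → Con P
  Πᶜ φ = record
    { rel = λ x y → ∀ i → rel (φ i) (x i) (y i)
    ; isEquiv = record { refl = λ i → con-refl (φ i) ; sym = λ p i → con-sym (φ i) (p i)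
                       ; trans = λ p q i → con-trans (φ i) (p i) (q i) }
    ; ≈⇒rel = λ e i → ≈⇒rel (φ i) (e i)
    ; compat = λ f ps i → compat (φ i) f (λ k → ps k i) }

  eval-Π : (t : Term S) (ρ : ℕ → Carrier P) (i : Fin n) →
    _≈_ (A i) (⟦ t ⟧ P ρ i) (⟦ t ⟧ (A i) (λ x → ρ x i))
  eval-Π (var x)    ρ i = ≈-refl (A i)
  eval-Π (app f ts) ρ i = op-cong (A i) f (λ k → eval-Π (ts k) ρ i)

  Π-models : (E : Term S → Term S → Set) → (∀ i → Models E (A i)) → Models E P
  Π-models E ms s t e ρ i = ≈-trans (A i) (eval-Π s ρ i)
    (≈-trans (A i) (ms i s t e (λ x → ρ x i)) (≈-sym (A i) (eval-Π t ρ i)))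

  pullback : (i : Fin n) → Con (A i) → Con P
  pullback i θᵢ = preimage (proj i) θᵢ (≈⇒rel θᵢ)

  projᵠ : (i : Fin n) (θᵢ : Con (A i)) → Hom (P / pullback i θᵢ) (A i / θᵢ)
  projᵠ i θᵢ = quotient-hom (proj i) (pullback i θᵢ) θᵢ (≈⇒rel θᵢ) (λ t → t)

  pullbackᵠ : (i : Fin n) (θᵢ : Con (A i)) → Con (A i / θᵢ) → Con (P / pullback i θᵢ)
  pullbackᵠ i θᵢ βᵢ = preimage (projᵠ i θᵢ) βᵢ (≈⇒rel βᵢ)

module Components {S : Signature} {n : ℕ} (A : Fin n → Algebra S)
                  (c : (i : Fin n) → Carrier (A i)) (cd : CongDistributive (Π A)) where
  open Product A

  ι : (i : Fin n) → Carrier (A i) → Carrier P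
  ι = update c

  ι-at≈ : (i : Fin n) {a : Carrier (A i)} → _≈_ (A i) (ι i a i) a
  ι-at≈ i {a} = subst₂ (_≈_ (A i)) refl (update-at c i a) (≈-refl (A i))

  to-ι : (i : Fin n) (κ : Con (A i)) → ∀ {a b} → rel κ a b → rel κ (ι i a i) (ι i b i)
  to-ι i κ {a} {b} = subst₂ (rel κ) (sym (update-at c i a)) (sym (update-at c i b))

  from-ι : (i : Fin n) (κ : Con (A i)) → ∀ {a b} → rel κ (ι i a i) (ι i b i) → rel κ a b
  from-ι i κ {a} {b} = subst₂ (rel κ) (update-at c i a) (update-at c i b)

  emb : (i : Fin n) → HomUpTo (A i) P (η i)
  emb i = record
    { map = ι i
    ; resp = to-ι i Δ
    ; op-hom = λ f xs →
        ≈-trans (A i) (ι-at≈ i) (op-cong (A i) f (λ k → ≈-sym (A i) (ι-at≈ i))) }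

  component : Con P → (i : Fin n) → Con (A i)
  component κ i = preimage (emb i) (κ ∨ η i) (λ e → g-base (inj₂ e))

  -- x ~κ y implies xᵢ ~ yᵢ in the i-th component, because ι xᵢ ~ηᵢ x
  component-proj : (κ : Con P) (i : Fin n) → ∀ {x y} →
    rel κ x y → rel (component κ i) (x i) (y i)
  component-proj κ i k = g-trans (g-base (inj₂ (ι-at≈ i)))
    (g-trans (g-base (inj₁ k)) (g-base (inj₂ (≈-sym (A i) (ι-at≈ i)))))

  component-join-kernel : (κ : Con P) (i : Fin n) → ∀ {x y} →
    rel (component κ i) (x i) (y i) → rel (κ ∨ η i) x y
  component-join-kernel κ i d =
    g-trans (g-base (inj₂ (≈-sym (A i) (ι-at≈ i)))) (g-trans d (g-base (inj₂ (ι-at≈ i))))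

  component-mono : (κ κ' : Con P) → κ ≤C κ' → (i : Fin n) →
    component κ i ≤C component κ' i
  component-mono κ κ' h i {a} {b} = ∨-monoˡ P κ κ' (η i) h {ι i a} {ι i b}

  -- Fraser–Horn: κ is the product of its components, since ⋀ᵢ (κ ∨ ηᵢ) ≤ κ ∨ ⋀ᵢ ηᵢ = κ
  fraser-horn : (κ : Con P) → Πᶜ (component κ) ≤C κ
  fraser-horn κ H = Gen-least P κ (λ { (inj₁ k) → k ; (inj₂ e) → ≈⇒rel κ e })
    (⋀-dual-distrib P cd κ η (λ i → component-join-kernel κ i (H i)))

  -- components preserve binary meets, by the dual distributive law
  component-∧ : (κ κ' : Con P) (i : Fin n) →
    (component κ i ∧ component κ' i) ≤C component (κ ∧ κ') i
  component-∧ κ κ' i (p , q) = ∨-comm P (η i) (κ ∧ κ')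
    (∨-dual-distrib P cd (η i) κ κ' (∨-comm P κ (η i) p , ∨-comm P κ' (η i) q))

  -- the components of Δ are trivial, as Δ ∨ ηᵢ = ηᵢ
  component-Δ : (i : Fin n) → component Δ i ≤C Δ
  component-Δ i {a} {b} d =
    from-ι i Δ (Gen-least P (η i) (λ { (inj₁ e) → e i ; (inj₂ e) → e }) {ι i a} {ι i b} d)

  factor≤component : (φ : (i : Fin n) → Con (A i)) (i : Fin n) → φ i ≤C component (Πᶜ φ) i
  factor≤component φ i r =
    g-base (inj₁ (update-rel c (λ j → rel (φ j)) (λ j → con-refl (φ j)) i r))

  -- products of congruences commute with joins (the other inclusion is immediate)
  Πᶜ-∨ : (φ ψ : (i : Fin n) → Con (A i)) → Πᶜ (λ i → φ i ∨ ψ i) ≤C (Πᶜ φ ∨ Πᶜ ψ)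
  Πᶜ-∨ φ ψ H = fraser-horn (Πᶜ φ ∨ Πᶜ ψ)
    (λ i → Gen-least (A i) (component (Πᶜ φ ∨ Πᶜ ψ) i) (factors i) (H i))
    where
    factors : (i : Fin n) → ∀ {a b} → rel (φ i) a b ⊎ rel (ψ i) a b →
      rel (component (Πᶜ φ ∨ Πᶜ ψ) i) a b
    factors i (inj₁ r) = component-mono (Πᶜ φ) (Πᶜ φ ∨ Πᶜ ψ) (λ p → g-base (inj₁ p)) i
                           (factor≤component φ i r)
    factors i (inj₂ r) = component-mono (Πᶜ ψ) (Πᶜ φ ∨ Πᶜ ψ) (λ p → g-base (inj₂ p)) i
                           (factor≤component ψ i r)

  Πᶜ-boolean : (φ : (i : Fin n) → Con (A i)) → (∀ i → IsBoolean (φ i)) → IsBoolean (Πᶜ φ)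
  Πᶜ-boolean φ bool = complemented P (Πᶜ φ) (Πᶜ φ')
      (λ (p , q) i → proj₁ (proj₁ (proj₂ (bool i))) (p i , q i))
      (λ _ → Πᶜ-∨ φ φ' (λ i → proj₂ (proj₂ (proj₂ (bool i))) tt))
    where
    φ' : (i : Fin n) → Con (A i)
    φ' i = proj₁ (bool i)

  component-boolean : (α : Con P) → IsBoolean α → (i : Fin n) → IsBoolean (component α i)
  component-boolean α (α' , (meet , _) , (_ , cover)) i =
    complemented (A i) (component α i) (component α' i)
      (λ pq → component-Δ i (component-mono (α ∧ α') Δ meet i (component-∧ α α' i pq)))
      (join-cover-image (proj i) α α' (component α i) (component α' i)
        (component-proj α i) (component-proj α' i) (ι i) (λ _ → ι-at≈ i) cover)

  componentᵠ : (θ : Con P) → Con (P / θ) → (i : Fin n) → Con (A i / component θ i)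
  componentᵠ θ β i = raise (A i) (component θ i) (component (lower P θ β) i)
                       (component-mono θ (lower P θ β) (≈⇒rel β) i)

  projᶜ : (θ : Con P) (i : Fin n) → Hom (P / θ) (A i / component θ i)
  projᶜ θ i = quotient-hom (proj i) θ (component θ i) (≈⇒rel (component θ i)) (component-proj θ i)

  componentᵠ-boolean : (θ : Con P) (β : Con (P / θ)) → IsBoolean β → (i : Fin n) →
    IsBoolean (componentᵠ θ β i)
  componentᵠ-boolean θ β (β' , (meet , _) , (_ , cover)) i =
    complemented (A i / component θ i) (componentᵠ θ β i) (componentᵠ θ β' i)
      (λ pq → component-mono (βₚ ∧ β'ₚ) θ meet i (component-∧ βₚ β'ₚ i pq))
      (join-cover-image (projᶜ θ i) β β' (componentᵠ θ β i) (componentᵠ θ β' i)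
        (component-proj βₚ i) (component-proj β'ₚ i)
        (ι i) (λ _ → ≈⇒rel (component θ i) (ι-at≈ i)) cover)
    where
    βₚ β'ₚ : Con P
    βₚ = lower P θ β
    β'ₚ = lower P θ β'

  u-Πᶜ : (θ : Con P) (β : Con (P / θ)) (φ : (i : Fin n) → Con (A i)) →
    (∀ i → u (component θ i) (φ i) ≅C componentᵠ θ β i) → u θ (Πᶜ φ) ≅C β
  u-Πᶜ θ β φ lifts = Gen-least P (lower P θ β) below , above
    where
    below : ∀ {x y} → rel (Πᶜ φ) x y ⊎ rel θ x y → rel β x y
    below (inj₁ p) = fraser-horn (lower P θ β) (λ i → proj₁ (lifts i) (g-base (inj₁ (p i))))
    below (inj₂ t) = ≈⇒rel β t
    above : β ≤C u θ (Πᶜ φ)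
    above b = ∨-monoʳ P (Πᶜ φ) (Πᶜ (component θ)) θ (fraser-horn θ)
      (Πᶜ-∨ φ (component θ) (λ i → proj₂ (lifts i) (component-proj (lower P θ β) i b)))

  embᵠ : (i : Fin n) (θᵢ : Con (A i)) → Hom (A i / θᵢ) (P / pullback i θᵢ)
  embᵠ i θᵢ = quotient-hom (emb i) θᵢ (pullback i θᵢ) (≈⇒rel θᵢ) (to-ι i θᵢ)

  -- pullbackᵠ preserves Boolean congruences; x ↦ xᵢ is a section of ι modulo pullback θᵢ
  pullbackᵠ-boolean : (i : Fin n) (θᵢ : Con (A i)) (βᵢ : Con (A i / θᵢ)) → IsBoolean βᵢ →
    IsBoolean (pullbackᵠ i θᵢ βᵢ)
  pullbackᵠ-boolean i θᵢ βᵢ (β'ᵢ , (meet , _) , (_ , cover)) =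
    complemented (P / pullback i θᵢ) (pullbackᵠ i θᵢ βᵢ) (pullbackᵠ i θᵢ β'ᵢ) meet
      (join-cover-image (embᵠ i θᵢ) βᵢ β'ᵢ (pullbackᵠ i θᵢ βᵢ) (pullbackᵠ i θᵢ β'ᵢ)
        (to-ι i (lower (A i) θᵢ βᵢ)) (to-ι i (lower (A i) θᵢ β'ᵢ))
        (λ x → x i) (λ _ → ≈⇒rel θᵢ (ι-at≈ i)) cover)

  u-component : (i : Fin n) (θᵢ : Con (A i)) (βᵢ : Con (A i / θᵢ)) (α : Con P) →
    u (pullback i θᵢ) α ≅C pullbackᵠ i θᵢ βᵢ → u θᵢ (component α i) ≅C βᵢ
  u-component i θᵢ βᵢ α (below , above) = Gen-least (A i) βₗ downwards , upwards
    where
    βₗ : Con (A i)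
    βₗ = lower (A i) θᵢ βᵢ
    -- ηᵢ ≤ pullback θᵢ, so α ∨ ηᵢ ≤ α ∨ pullback θᵢ
    downwards : ∀ {a b} → rel (component α i) a b ⊎ rel θᵢ a b → rel βᵢ a b
    downwards (inj₁ d) = from-ι i βₗ (below (∨-monoʳ P α (η i) (pullback i θᵢ) (≈⇒rel θᵢ) d))
    downwards (inj₂ t) = ≈⇒rel βᵢ t
    upwards : βᵢ ≤C u θᵢ (component α i)
    upwards {a} {b} r = from-ι i (component α i ∨ θᵢ)
      (join-image (proj i) α (pullback i θᵢ) (component α i) θᵢ (component-proj α i) (λ t → t)
        {ι i a} {ι i b} (above (to-ι i βₗ r)))

  -- factors ⇒ product: lift the components of θ and β in each factor
  CBLP-of-factors : ((i : Fin n) → HasCBLP (A i)) → HasCBLP P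
  CBLP-of-factors hyp θ β β-boolean =
    Πᶜ α , Πᶜ-boolean α (λ i → proj₁ (proj₂ (lifted i)))
         , u-Πᶜ θ β α (λ i → proj₂ (proj₂ (lifted i)))
    where
    lifted : (i : Fin n) →
      Σ (Con (A i)) λ αᵢ → IsBoolean αᵢ × (u (component θ i) αᵢ ≅C componentᵠ θ β i)
    lifted i = hyp i (component θ i) (componentᵠ θ β i) (componentᵠ-boolean θ β β-boolean i)
    α : (i : Fin n) → Con (A i)
    α i = proj₁ (lifted i)

  -- product ⇒ factors: lift the pull-backs of θᵢ and βᵢ in P, then take the i-th component
  CBLP-of-product : HasCBLP P → (i : Fin n) → HasCBLP (A i)
  CBLP-of-product hyp i θᵢ βᵢ βᵢ-boolean
    with hyp (pullback i θᵢ) (pullbackᵠ i θᵢ βᵢ) (pullbackᵠ-boolean i θᵢ βᵢ βᵢ-boolean)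
  ... | α , α-boolean , lifts =
    component α i , component-boolean α α-boolean i , u-component i θᵢ βᵢ α lifts

-- The product lies in the class, so it is congruence distributive; non-emptiness
-- of the factors supplies the base point.
corollary4p29 : (S : Signature) (E : Term S → Term S → Set) →
    ((A : Algebra S) → Models E A → CongDistributive A) →
    ((A : Algebra S) → Models E A → NonEmpty A → NablaCompact A) →
    (n : ℕ) → 1 ≤ n → (A : Fin n → Algebra S) →
    ((i : Fin n) → Models E (A i)) → ((i : Fin n) → NonEmpty (A i)) →
    HasCBLP (Π A) ⇔ ((i : Fin n) → HasCBLP (A i))
corollary4p29 S E distributive _ n _ A models nonEmpty =
  mk⇔ CBLP-of-product CBLP-of-factors
  where
  open Components A nonEmpty (distributive (Π A) (Product.Π-models A E models))
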